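{- Let $\mu$ be a partition and $p\in\mathbb Z$ with $p+|\mu|\ge 0$. Let $a=\min\{i\in\mathbb N: p\ge \mu'_i-i\}$, and define $\mu^{(p)}$ by its column lengths \[ (\mu^{(p)})'_i=\begin{cases}\mu'_i-1 & i<a,\\ p+a-1 & i=a,\\ \mu'_{i-1} & i>a.\end{cases} \] Then \[ (-1)^{a+1}f^{\mu^{(p)}}=\sum_{i=0}^{|\mu|}(-1)^i\binom{p+|\mu|}{p+i}f^{\mu/(i)}. \] In particular, if $p=\mu'_a-a$, then $\sum_{i=0}^{|\mu|}(-1)^i\binom{p+|\mu|}{p+i}f^{\mu/(i)}=0$.
   Context: $\mathbb N=\{1,2,\dots\}$. For a partition $\mu$, $\mu'_i$ denotes the length of the $i$-th column of its Young diagram (the number of parts of $\mu$ that are $\ge i$), which is $0$ for large $i$. $(i)$ is the one-row partition with $i$ boxes. $f^{\alpha}$ is the number of standard Young tableaux of the skew shape $\alpha$, with the convention $f^\alpha=0$ whenever $\alpha$ is not a valid (skew) partition shape (e.g. if $(i)\not\subseteq\mu$, or if the column lengths defining $\mu^{(p)}$ are not weakly decreasing nonnegative integers). Binomial coefficients $\binom{m}{j}$ are $0$ when $j<0$ or $j>m$. -}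

module Defs where

open import Data.Nat as ℕ using (ℕ; zero; suc; _≤?_; _<ᵇ_; _≡ᵇ_; _∸_; _≤ᵇ_)
open import Data.Nat.Combinatorics using (_C_)
open import Data.Integer as ℤ using (ℤ; +_; -[1+_]; _-_; _^_)
open import Data.List using (List; []; _∷_; length; filter; map; foldr; upTo; _++_)
open import Data.Nat.ListAction using (sum)
open import Data.List.Properties using (≡-dec)
open import Data.List.Relation.Unary.All using (All)
open import Data.List.Relation.Unary.Linked using (Linked)
open import Data.Bool using (if_then_else_)
open import Relation.Nullary.Decidable using (does)

-- A partition is a list of row lengths, weakly decreasing, all positive.
IsPartition : List ℕ → Set
IsPartition μ = Linked ℕ._≥_ μ × All (ℕ._<_ 0) μ
  where open import Data.Product using (_×_)

size : List ℕ → ℕ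
size = sum

conj : List ℕ → ℕ → ℕ
conj μ i = length (filter (λ x → i ≤? x) μ)

oneRow : ℕ → List ℕ
oneRow zero = []
oneRow (suc k) = suc k ∷ []

private
  headOr0 : List ℕ → ℕ
  headOr0 [] = 0
  headOr0 (x ∷ _) = x

  tail' : List ℕ → List ℕ
  tail' [] = []
  tail' (_ ∷ xs) = xs

  shrink : ℕ → List ℕ → List ℕ
  shrink x rest with x ∸ 1
  ... | zero = rest
  ... | suc y = suc y ∷ rest

-- All shapes κ obtained from the partition λ by removing one corner box
-- such that κ still contains ν in the changed row (ν ⊆ κ is tracked row by row).
preds : List ℕ → List ℕ → List (List ℕ)
preds [] ν = []
preds (x ∷ rest) ν =
  (if (headOr0 rest <ᵇ x) Data.Bool.∧ (headOr0 ν ≤ᵇ (x ∸ 1))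
     then shrink x rest ∷ [] else [])
  ++ map (x ∷_) (preds rest (tail' ν))

-- number of saturated chains ν = κ₀ ⊂ κ₁ ⊂ … ⊂ κₙ = λ in Young's lattice
-- (each step adds one box), with n given as fuel
chains : ℕ → List ℕ → List ℕ → ℕ
chains zero λ′ ν = if does (≡-dec ℕ._≟_ λ′ ν) then 1 else 0
chains (suc n) λ′ ν = sum (map (λ κ → chains n κ ν) (preds λ′ ν))

-- f^{λ/ν}: number of standard Young tableaux of skew shape λ/ν
-- (= number of saturated chains from ν to λ); it is 0 if ν ⊄ λ.
fSkew : List ℕ → List ℕ → ℕ
fSkew λ′ ν = chains (size λ′ ∸ size ν) λ′ ν

fStraight : List ℕ → ℕ
fStraight λ′ = fSkew λ′ []

-- binomial coefficient (m choose j) for integer j; 0 for j < 0 or j > m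
binomℤ : ℕ → ℤ → ℕ
binomℤ m (+ j) = m C j
binomℤ m -[1+ _ ] = 0

sgn : ℕ → ℤ
sgn k = ℤ.-1ℤ ^ k

Σ0to : ℕ → (ℕ → ℤ) → ℤ
Σ0to n g = foldr ℤ._+_ (+ 0) (map g (upTo (suc n)))

IsMinA : List ℕ → ℤ → ℕ → Set
IsMinA μ p a =
  (1 ℕ.≤ a) × (+ conj μ a - + a ℤ.≤ p) ×
  ((i : ℕ) → 1 ℕ.≤ i → i ℕ.< a → p ℤ.< + conj μ i - + i)
  where open import Data.Product using (_×_)

colP : List ℕ → ℤ → ℕ → ℕ → ℤ
colP μ p a i =
  if i <ᵇ a then + conj μ i - ℤ.1ℤ
  else if i ≡ᵇ a then p ℤ.+ + a - ℤ.1ℤ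
  else + conj μ (i ∸ 1)

HasColumns : List ℕ → (ℕ → ℤ) → Set
HasColumns λ′ c = IsPartition λ′ Data.Product.× ((i : ℕ) → 1 ℕ.≤ i → + conj λ′ i ≡ c i)
  where open import Relation.Binary.PropositionalEquality using (_≡_)
        import Data.Product

RHS : List ℕ → ℤ → ℤ
RHS μ p = Σ0to (size μ) (λ i →
  sgn i ℤ.* (+ binomℤ ℤ.∣ p ℤ.+ + size μ ∣ (p ℤ.+ + i)) ℤ.* + fSkew μ (oneRow i))

-- Write φ μ L = L − μ_{L+1} (rows indexed from 0); it is strictly increasing in L.  By induction
-- on p + |μ|, the alternating sum equals (−1)^{μ_{L+1}} f^{Ψ_L μ} when p = φ μ L, where Ψ_L μ
-- deletes row L of μ and lengthens every earlier row by one, and it vanishes when p is not a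
-- value of φ μ.  In the induction step Pascal's rule for the binomial and the branching rule
-- f^{μ/(i)} = Σ_{κ ⋖ μ} f^{κ/(i)} express the sum for (μ, p) through the sums for (κ, p) and
-- for (μ, p − 1).  The corners of Ψ_L μ are the images under Ψ_L of the corners of μ off row L,
-- plus one more exactly when μ_L = μ_{L+1}, and that one is supplied by the (μ, p − 1) term;
-- when p is not a value of φ μ the terms cancel in pairs.  Finally, minimality of a forces
-- a = μ_{L+1} + 1, and Ψ_L μ is then the partition whose columns are those of μ^{(p)}.

module Submission where

open import Defs
open import Data.Nat using (ℕ; zero; suc; z≤n; s≤s)
import Data.Nat as ℕ
import Data.Nat.Properties as ℕₚ
open import Data.Nat.ListAction using (sum)
open import Data.Nat.Combinatorics using (_C_; nCk+nC[k+1]≡[n+1]C[k+1]; k>n⇒nCk≡0)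
import Data.Nat.Tactic.RingSolver as ℕ-Solver
open import Data.Integer as ℤ using (ℤ; +_; -[1+_]; _+_; _*_; _≤_; _-_)
import Data.Integer.Properties as ℤₚ
open import Data.Integer.Tactic.RingSolver using (solve-∀)
open import Data.List using (List; []; _∷_; map; _++_; foldr; length; filter; applyUpTo)
open import Data.List.Properties using (≡-dec; map-∘; map-cong-local; filter-accept; filter-reject)
open import Data.List.Relation.Unary.All as All using (All; []; _∷_)
open import Data.List.Relation.Unary.All.Properties using (++⁺; map⁺; map⁻; ++⁻ˡ; ++⁻ʳ)
open import Data.List.Relation.Unary.Linked using ([]; [-]; _∷_)
open import Data.Bool using (true; false; if_then_else_; T; _∧_)
open import Data.Bool.Properties using (∧-zeroʳ)
open import Data.Product using (Σ; _,_; proj₁; proj₂; _×_)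
open import Data.Sum using (_⊎_; inj₁; inj₂)
open import Data.Empty using (⊥-elim)
open import Function using (_∘_; case_of_)
open import Relation.Binary.PropositionalEquality
open import Relation.Binary.Definitions using (tri<; tri≈; tri>)
open import Relation.Nullary using (yes; no; ¬_)
open import Relation.Nullary.Decidable using (dec-true; dec-false)

row : ℕ → List ℕ → ℕ
row _ [] = 0
row zero (x ∷ _) = x
row (suc i) (_ ∷ xs) = row i xs

tail-isPartition : ∀ {x xs} → IsPartition (x ∷ xs) → IsPartition xs
tail-isPartition ([-] , _ ∷ ps) = [] , ps
tail-isPartition (_ ∷ l , _ ∷ ps) = l , ps

head-positive : ∀ {x xs} → IsPartition (x ∷ xs) → 1 ℕ.≤ x
head-positive (_ , p ∷ _) = p

second≤head : ∀ {x xs} → IsPartition (x ∷ xs) → row 0 xs ℕ.≤ x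
second≤head ([-] , _) = z≤n
second≤head (r ∷ _ , _) = r

cons-isPartition : ∀ {x xs} → row 0 xs ℕ.≤ x → 1 ℕ.≤ x → IsPartition xs → IsPartition (x ∷ xs)
cons-isPartition {xs = []} _ p _ = [-] , p ∷ []
cons-isPartition {xs = _ ∷ _} h p (l , ps) = h ∷ l , p ∷ ps

row0≡0⇒[] : ∀ {xs} → IsPartition xs → row 0 xs ≡ 0 → xs ≡ []
row0≡0⇒[] {[]} _ _ = refl
row0≡0⇒[] {_ ∷ _} P refl = case head-positive P of λ ()

row-suc-≤ : ∀ {μ} → IsPartition μ → ∀ i → row (suc i) μ ℕ.≤ row i μ
row-suc-≤ {[]} _ _ = z≤n
row-suc-≤ {_ ∷ _} P zero = second≤head P
row-suc-≤ {_ ∷ _} P (suc i) = row-suc-≤ (tail-isPartition P) i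

row-antitone : ∀ {μ} → IsPartition μ → ∀ {i j} → i ℕ.≤ j → row j μ ℕ.≤ row i μ
row-antitone {μ} P {i} i≤j with ℕₚ.m≤n⇒∃[o]m+o≡n i≤j
... | k , refl = go k
  where
  go : ∀ k → row (i ℕ.+ k) μ ℕ.≤ row i μ
  go zero rewrite ℕₚ.+-identityʳ i = ℕₚ.≤-refl
  go (suc k) rewrite ℕₚ.+-suc i k = ℕₚ.≤-trans (row-suc-≤ P (i ℕ.+ k)) (go k)

rows≤head : ∀ {x xs} → IsPartition (x ∷ xs) → ∀ i → row i xs ℕ.≤ x
rows≤head P i = ℕₚ.≤-trans (row-antitone (tail-isPartition P) z≤n) (second≤head P)

row≤size : ∀ L μ → row L μ ℕ.≤ size μ
row≤size L [] = z≤n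
row≤size zero (x ∷ μ) = ℕₚ.m≤m+n x _
row≤size (suc L) (x ∷ μ) = ℕₚ.≤-trans (row≤size L μ) (ℕₚ.m≤n+m _ x)

size≡0⇒[] : ∀ {xs} → IsPartition xs → size xs ≡ 0 → xs ≡ []
size≡0⇒[] {xs} P e = row0≡0⇒[] P (ℕₚ.n≤0⇒n≡0 (subst (row 0 xs ℕ.≤_) e (row≤size 0 xs)))

row-ext : ∀ {λ₁ λ₂} → IsPartition λ₁ → IsPartition λ₂ → (∀ L → row L λ₁ ≡ row L λ₂) → λ₁ ≡ λ₂
row-ext {[]} {[]} _ _ _ = refl
row-ext {[]} {_ ∷ _} _ Q f = ⊥-elim (ℕₚ.<-irrefl (f 0) (head-positive Q))
row-ext {_ ∷ _} {[]} P _ f = ⊥-elim (ℕₚ.<-irrefl (sym (f 0)) (head-positive P))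
row-ext {_ ∷ _} {_ ∷ _} P Q f =
  cong₂ _∷_ (f 0) (row-ext (tail-isPartition P) (tail-isPartition Q) (λ L → f (suc L)))

conj-∷-≤ : ∀ {i x} xs → i ℕ.≤ x → conj (x ∷ xs) i ≡ suc (conj xs i)
conj-∷-≤ {i} _ le = cong length (filter-accept (i ℕ.≤?_) le)

conj-∷-≰ : ∀ {i x} xs → ¬ i ℕ.≤ x → conj (x ∷ xs) i ≡ conj xs i
conj-∷-≰ {i} _ nle = cong length (filter-reject (i ℕ.≤?_) nle)

conj-suc-≤ : ∀ λ′ a → conj λ′ (suc a) ℕ.≤ conj λ′ a
conj-suc-≤ [] a = z≤n
conj-suc-≤ (x ∷ xs) a with suc a ℕ.≤? x | a ℕ.≤? x
... | yes a<x | _ rewrite conj-∷-≤ xs a<x | conj-∷-≤ {a} xs (ℕₚ.<⇒≤ a<x) = s≤s (conj-suc-≤ xs a)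
... | no a≮x | yes a≤x rewrite conj-∷-≰ xs a≮x | conj-∷-≤ xs a≤x = ℕₚ.m≤n⇒m≤1+n (conj-suc-≤ xs a)
... | no a≮x | no a≰x rewrite conj-∷-≰ xs a≮x | conj-∷-≰ xs a≰x = conj-suc-≤ xs a

conj≡0 : ∀ {xs} j → IsPartition xs → row 0 xs ℕ.< j → conj xs j ≡ 0
conj≡0 {[]} _ _ _ = refl
conj≡0 {x ∷ xs} j P lt rewrite conj-∷-≰ {j} xs (ℕₚ.<⇒≱ lt) =
  conj≡0 j (tail-isPartition P) (ℕₚ.≤-<-trans (second≤head P) lt)

≤row⇒<conj : ∀ {μ} → IsPartition μ → ∀ L a → 1 ℕ.≤ a → a ℕ.≤ row L μ → L ℕ.< conj μ a
≤row⇒<conj {[]} _ L a p le = ⊥-elim (ℕₚ.<-irrefl refl (ℕₚ.≤-trans p le))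
≤row⇒<conj {x ∷ xs} P zero a p le rewrite conj-∷-≤ {a} xs le = s≤s z≤n
≤row⇒<conj {x ∷ xs} P (suc L) a p le rewrite conj-∷-≤ {a} xs (ℕₚ.≤-trans le (rows≤head P L)) =
  s≤s (≤row⇒<conj (tail-isPartition P) L a p le)

<conj⇒≤row : ∀ {μ} → IsPartition μ → ∀ L a → 1 ℕ.≤ a → L ℕ.< conj μ a → a ℕ.≤ row L μ
<conj⇒≤row {[]} _ L a p ()
<conj⇒≤row {x ∷ xs} P L a p lt with a ℕ.≤? x
<conj⇒≤row {x ∷ xs} P zero a p lt | yes a≤x = a≤x
<conj⇒≤row {x ∷ xs} P (suc L) a p lt | yes a≤x rewrite conj-∷-≤ {a} xs a≤x =
  <conj⇒≤row (tail-isPartition P) L a p (ℕₚ.≤-pred lt)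
... | no a≰x rewrite conj-∷-≰ {a} xs a≰x
                   | conj≡0 a (tail-isPartition P) (ℕₚ.≤-<-trans (second≤head P) (ℕₚ.≰⇒> a≰x)) =
  case lt of λ ()

conj-injective : ∀ {λ₁ λ₂} → IsPartition λ₁ → IsPartition λ₂ →
                 (∀ i → 1 ℕ.≤ i → conj λ₁ i ≡ conj λ₂ i) → λ₁ ≡ λ₂
conj-injective P Q f = row-ext P Q λ L → ℕₚ.≤-antisym (row≤ Q P f L) (row≤ P Q (λ i p → sym (f i p)) L)
  where
  row≤ : ∀ {α β} → IsPartition α → IsPartition β → (∀ i → 1 ℕ.≤ i → conj β i ≡ conj α i) →
         ∀ L → row L β ℕ.≤ row L α
  row≤ {α} {β} A B g L with row L β in eq
  ... | zero = z≤n
  ... | suc b = <conj⇒≤row A L (suc b) (s≤s z≤n)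
                  (subst (L ℕ.<_) (g (suc b) (s≤s z≤n)) (≤row⇒<conj B L (suc b) (s≤s z≤n) (ℕₚ.≤-reflexive (sym eq))))

dropBox : ℕ → List ℕ → List ℕ
dropBox zero r = r
dropBox (suc zero) r = r
dropBox (suc (suc y)) r = suc y ∷ r

corners : ℕ → List ℕ → List (List ℕ)
corners x rest = if row 0 rest ℕ.<ᵇ x then dropBox x rest ∷ [] else []

preds-[] : ∀ x rest → preds (x ∷ rest) [] ≡ corners x rest ++ map (x ∷_) (preds rest [])
preds-[] zero [] = refl
preds-[] (suc zero) [] = refl
preds-[] (suc (suc y)) [] = refl
preds-[] zero (y ∷ ys) = refl
preds-[] (suc x) (y ∷ ys) with y ℕ.<ᵇ suc x
... | false = refl
preds-[] (suc zero) (y ∷ ys) | true = refl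
preds-[] (suc (suc x)) (y ∷ ys) | true = refl

preds-oneRow : ∀ k x rest → preds (x ∷ rest) (oneRow (suc k)) ≡
  (if (row 0 rest ℕ.<ᵇ x) ∧ (suc k ℕ.≤ᵇ x ℕ.∸ 1) then dropBox x rest ∷ [] else [])
  ++ map (x ∷_) (preds rest [])
preds-oneRow k zero [] = refl
preds-oneRow k (suc zero) [] = refl
preds-oneRow k (suc (suc y)) [] with k ℕ.<ᵇ suc y
... | false = refl
... | true = refl
preds-oneRow k zero (y ∷ ys) = refl
preds-oneRow k (suc x) (y ∷ ys) with y ℕ.<ᵇ suc x
... | false = refl
preds-oneRow k (suc zero) (y ∷ ys) | true = refl
preds-oneRow k (suc (suc x)) (y ∷ ys) | true with k ℕ.<ᵇ suc x
... | false = refl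
... | true = refl

rest≡[] : ∀ {x rest} → IsPartition (x ∷ rest) → T (row 0 rest ℕ.<ᵇ 1) → rest ≡ []
rest≡[] {rest = rest} P t =
  row0≡0⇒[] (tail-isPartition P) (ℕₚ.n<1⇒n≡0 (ℕₚ.<ᵇ⇒< (row 0 rest) 1 t))

record _⋖_ (κ μ : List ℕ) : Set where
  field
    isPartition : IsPartition κ
    size-suc    : suc (size κ) ≡ size μ
    rows        : ∀ i → row i κ ≡ row i μ ⊎ suc (row i κ) ≡ row i μ

⋖-row0 : ∀ {κ μ} → κ ⋖ μ → row 0 κ ℕ.≤ row 0 μ
⋖-row0 κ⋖μ with _⋖_.rows κ⋖μ 0
... | inj₁ e = ℕₚ.≤-reflexive e
... | inj₂ e = subst (_ ℕ.≤_) e (ℕₚ.n≤1+n _)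

dropBox-⋖ : ∀ x rest → IsPartition (x ∷ rest) → T (row 0 rest ℕ.<ᵇ x) → dropBox x rest ⋖ (x ∷ rest)
dropBox-⋖ zero rest P t = ⊥-elim (ℕₚ.<-irrefl refl (head-positive P))
dropBox-⋖ (suc zero) rest P t with rest≡[] P t
... | refl = record { isPartition = [] , [] ; size-suc = refl
                    ; rows = λ { zero → inj₂ refl ; (suc i) → inj₁ refl } }
dropBox-⋖ (suc (suc y)) rest P t = record
  { isPartition = cons-isPartition (ℕₚ.≤-pred (ℕₚ.<ᵇ⇒< (row 0 rest) _ t)) (s≤s z≤n) (tail-isPartition P)
  ; size-suc = refl
  ; rows = λ { zero → inj₂ refl ; (suc i) → inj₁ refl } }

∷-⋖ : ∀ {x rest κ} → IsPartition (x ∷ rest) → κ ⋖ rest → (x ∷ κ) ⋖ (x ∷ rest)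
∷-⋖ {x} {κ = κ} P κ⋖rest = record
  { isPartition = cons-isPartition (ℕₚ.≤-trans (⋖-row0 κ⋖rest) (second≤head P)) (head-positive P) isPartition
  ; size-suc = trans (sym (ℕₚ.+-suc x (size κ))) (cong (x ℕ.+_) size-suc)
  ; rows = λ { zero → inj₁ refl ; (suc i) → rows i } }
  where open _⋖_ κ⋖rest

All-corners : ∀ {P : List ℕ → Set} x rest → (T (row 0 rest ℕ.<ᵇ x) → P (dropBox x rest)) → All P (corners x rest)
All-corners x rest f with row 0 rest ℕ.<ᵇ x
... | false = []
... | true = f _ ∷ []

preds-⋖ : ∀ {μ} → IsPartition μ → All (_⋖ μ) (preds μ [])
preds-⋖ {[]} P = []
preds-⋖ {x ∷ rest} P rewrite preds-[] x rest =
  ++⁺ (All-corners x rest (dropBox-⋖ x rest P))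
      (map⁺ (All.map (∷-⋖ P) (preds-⋖ (tail-isPartition P))))

T⇒≡true : ∀ {b} → T b → b ≡ true
T⇒≡true {true} _ = refl

¬T⇒≡false : ∀ {b} → ¬ T b → b ≡ false
¬T⇒≡false {false} _ = refl
¬T⇒≡false {true} f = ⊥-elim (f _)

<ᵇ≡true : ∀ {m n} → m ℕ.< n → (m ℕ.<ᵇ n) ≡ true
<ᵇ≡true lt = T⇒≡true (ℕₚ.<⇒<ᵇ lt)

<ᵇ≡false : ∀ {m n} → n ℕ.≤ m → (m ℕ.<ᵇ n) ≡ false
<ᵇ≡false {m} {n} ge = ¬T⇒≡false (λ t → ℕₚ.<⇒≱ (ℕₚ.<ᵇ⇒< m n t) ge)

≡ᵇ≡true : ∀ {m n} → m ≡ n → (m ℕ.≡ᵇ n) ≡ true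
≡ᵇ≡true {m} {n} e = T⇒≡true (ℕₚ.≡⇒≡ᵇ m n e)

≡ᵇ≡false : ∀ {m n} → m ≢ n → (m ℕ.≡ᵇ n) ≡ false
≡ᵇ≡false {m} {n} ne = ¬T⇒≡false (λ t → ne (ℕₚ.≡ᵇ⇒≡ m n t))

fOneRow : ℕ → List ℕ → ℕ
fOneRow i μ = fSkew μ (oneRow i)

size-oneRow : ∀ i → size (oneRow i) ≡ i
size-oneRow zero = refl
size-oneRow (suc j) = cong suc (ℕₚ.+-identityʳ j)

fOneRow≡chains : ∀ i n μ → size μ ≡ i ℕ.+ n → fOneRow i μ ≡ chains n μ (oneRow i)
fOneRow≡chains i n μ e rewrite size-oneRow i | e = cong (λ k → chains k μ (oneRow i)) (ℕₚ.m+n∸m≡n i n)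

sum-map-≡0 : ∀ {f : List ℕ → ℕ} {xs} → All (λ κ → f κ ≡ 0) xs → sum (map f xs) ≡ 0
sum-map-≡0 [] = refl
sum-map-≡0 (e ∷ es) rewrite e | sum-map-≡0 es = refl

chains-oneRow≡0 : ∀ k κ j → row 0 κ ℕ.≤ j → chains k κ (oneRow (suc j)) ≡ 0
chains-oneRow≡0 zero κ j le with ≡-dec ℕₚ._≟_ κ (oneRow (suc j))
... | yes refl = ⊥-elim (ℕₚ.<-irrefl refl le)
... | no _ = refl
chains-oneRow≡0 (suc k) [] j le = refl
chains-oneRow≡0 (suc k) (x ∷ rest) j le
  rewrite preds-oneRow j x rest
        | <ᵇ≡false {j} {x ℕ.∸ 1} (ℕₚ.≤-trans (ℕₚ.m∸n≤m x 1) le)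
        | ∧-zeroʳ (row 0 rest ℕ.<ᵇ x) =
  trans (cong sum (sym (map-∘ (preds rest []))))
        (sum-map-≡0 {xs = preds rest []} (All.tabulate λ {κ} _ → chains-oneRow≡0 k (x ∷ κ) j le))

row0-dropBox : ∀ x rest → row 0 rest ℕ.< x → row 0 (dropBox x rest) ℕ.≤ x ℕ.∸ 1
row0-dropBox (suc zero) rest lt = ℕₚ.≤-pred lt
row0-dropBox (suc (suc y)) rest lt = ℕₚ.≤-refl

chains-preds-oneRow : ∀ k j x rest →
  sum (map (λ κ → chains k κ (oneRow (suc j))) (preds (x ∷ rest) (oneRow (suc j)))) ≡
  sum (map (λ κ → chains k κ (oneRow (suc j))) (preds (x ∷ rest) []))
chains-preds-oneRow k j x rest rewrite preds-oneRow j x rest | preds-[] x rest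
  with row 0 rest ℕ.<ᵇ x in lt | suc j ℕ.≤ᵇ x ℕ.∸ 1 in fits
... | false | _ = refl
... | true | true = refl
... | true | false rewrite chains-oneRow≡0 k (dropBox x rest) j
        (ℕₚ.≤-trans (row0-dropBox x rest (ℕₚ.<ᵇ⇒< _ _ (subst T (sym lt) _)))
                     (ℕₚ.≮⇒≥ λ q → subst T fits (ℕₚ.≤⇒≤ᵇ q))) = refl

branching : ∀ i {μ} → IsPartition μ → i ℕ.< size μ → fOneRow i μ ≡ sum (map (fOneRow i) (preds μ []))
branching i {μ} P i<|μ| with ℕₚ.m≤n⇒∃[o]m+o≡n i<|μ|
... | k , e = begin
  fOneRow i μ
    ≡⟨ fOneRow≡chains i (suc k) μ (trans (sym e) (sym (ℕₚ.+-suc i k))) ⟩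
  sum (map (λ κ → chains k κ (oneRow i)) (preds μ (oneRow i)))
    ≡⟨ drop-first-row-condition i μ ⟩
  sum (map (λ κ → chains k κ (oneRow i)) (preds μ []))
    ≡⟨ cong sum (map-cong-local (All.map (λ κ⋖μ → sym (fOneRow≡chains i k _ (size-κ κ⋖μ))) (preds-⋖ P))) ⟩
  sum (map (fOneRow i) (preds μ [])) ∎
  where
  open ≡-Reasoning
  size-κ : ∀ {κ} → κ ⋖ μ → size κ ≡ i ℕ.+ k
  size-κ κ⋖μ = ℕₚ.suc-injective (trans (_⋖_.size-suc κ⋖μ) (sym e))
  drop-first-row-condition : ∀ i μ →
    sum (map (λ κ → chains k κ (oneRow i)) (preds μ (oneRow i))) ≡
    sum (map (λ κ → chains k κ (oneRow i)) (preds μ []))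
  drop-first-row-condition zero μ = refl
  drop-first-row-condition (suc j) [] = refl
  drop-first-row-condition (suc j) (x ∷ rest) = chains-preds-oneRow k j x rest

sumOver : (List ℕ → ℤ) → List (List ℕ) → ℤ
sumOver g = foldr (λ κ s → g κ + s) (+ 0)

sumOver-++ : ∀ g xs ys → sumOver g (xs ++ ys) ≡ sumOver g xs + sumOver g ys
sumOver-++ g [] ys = sym (ℤₚ.+-identityˡ _)
sumOver-++ g (x ∷ xs) ys = trans (cong (_+_ (g x)) (sumOver-++ g xs ys)) (sym (ℤₚ.+-assoc (g x) _ _))

sumOver-map : ∀ g (f : List ℕ → List ℕ) xs → sumOver g (map f xs) ≡ sumOver (λ κ → g (f κ)) xs
sumOver-map g f [] = refl
sumOver-map g f (x ∷ xs) = cong (_+_ (g (f x))) (sumOver-map g f xs)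

sumOver-cong : ∀ {g h xs} → All (λ κ → g κ ≡ h κ) xs → sumOver g xs ≡ sumOver h xs
sumOver-cong [] = refl
sumOver-cong (e ∷ es) = cong₂ _+_ e (sumOver-cong es)

sumOver-≡0 : ∀ {g xs} → All (λ κ → g κ ≡ + 0) xs → sumOver g xs ≡ + 0
sumOver-≡0 [] = refl
sumOver-≡0 (e ∷ es) = cong₂ _+_ e (sumOver-≡0 es)

*-sumOver : ∀ c h xs → c * sumOver h xs ≡ sumOver (λ κ → c * h κ) xs
*-sumOver c h [] = ℤₚ.*-zeroʳ c
*-sumOver c h (x ∷ xs) = trans (ℤₚ.*-distribˡ-+ c (h x) _) (cong (_+_ (c * h x)) (*-sumOver c h xs))

+sum≡sumOver : ∀ (f : List ℕ → ℕ) xs → + sum (map f xs) ≡ sumOver (λ κ → + f κ) xs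
+sum≡sumOver f [] = refl
+sum≡sumOver f (x ∷ xs) = trans (ℤₚ.pos-+ (f x) _) (cong (_+_ (+ f x)) (+sum≡sumOver f xs))

cornerTerm : (List ℕ → ℤ) → ℕ → List ℕ → ℤ
cornerTerm g x rest = if row 0 rest ℕ.<ᵇ x then g (dropBox x rest) else + 0

sumOver-corners : ∀ g x rest → sumOver g (corners x rest) ≡ cornerTerm g x rest
sumOver-corners g x rest with row 0 rest ℕ.<ᵇ x
... | false = refl
... | true = ℤₚ.+-identityʳ _

sumOver-preds-[] : ∀ g x rest → sumOver g (preds (x ∷ rest) []) ≡
  cornerTerm g x rest + sumOver (λ κ → g (x ∷ κ)) (preds rest [])
sumOver-preds-[] g x rest = begin
  sumOver g (preds (x ∷ rest) [])                        ≡⟨ cong (sumOver g) (preds-[] x rest) ⟩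
  sumOver g (corners x rest ++ map (x ∷_) (preds rest [])) ≡⟨ sumOver-++ g (corners x rest) _ ⟩
  _                                                        ≡⟨ cong₂ _+_ (sumOver-corners g x rest) (sumOver-map g (x ∷_) (preds rest [])) ⟩
  cornerTerm g x rest + sumOver (λ κ → g (x ∷ κ)) (preds rest []) ∎
  where open ≡-Reasoning

sumBelow : ℕ → (ℕ → ℤ) → ℤ
sumBelow zero g = + 0
sumBelow (suc n) g = sumBelow n g + g n

sumBelow-suc-shift : ∀ n g → sumBelow (suc n) g ≡ g 0 + sumBelow n (λ i → g (suc i))
sumBelow-suc-shift zero g = trans (ℤₚ.+-identityˡ (g 0)) (sym (ℤₚ.+-identityʳ (g 0)))
sumBelow-suc-shift (suc n) g = trans (cong (_+ g (suc n)) (sumBelow-suc-shift n g)) (ℤₚ.+-assoc (g 0) _ _)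

foldr-applyUpTo≡sumBelow : ∀ n (f : ℕ → ℕ) (g : ℕ → ℤ) →
  foldr _+_ (+ 0) (map g (applyUpTo f n)) ≡ sumBelow n (λ i → g (f i))
foldr-applyUpTo≡sumBelow zero f g = refl
foldr-applyUpTo≡sumBelow (suc n) f g =
  trans (cong (_+_ (g (f 0))) (foldr-applyUpTo≡sumBelow n (λ i → f (suc i)) g))
        (sym (sumBelow-suc-shift n (λ i → g (f i))))

Σ0to≡sumBelow : ∀ n g → Σ0to n g ≡ sumBelow (suc n) g
Σ0to≡sumBelow n g = foldr-applyUpTo≡sumBelow (suc n) (λ i → i) g

sumBelow-cong : ∀ n {g h} → (∀ i → i ℕ.< n → g i ≡ h i) → sumBelow n g ≡ sumBelow n h
sumBelow-cong zero f = refl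
sumBelow-cong (suc n) f = cong₂ _+_ (sumBelow-cong n (λ i lt → f i (ℕₚ.m<n⇒m<1+n lt))) (f n ℕₚ.≤-refl)

sumBelow-0 : ∀ n → sumBelow n (λ _ → + 0) ≡ + 0
sumBelow-0 zero = refl
sumBelow-0 (suc n) rewrite sumBelow-0 n = refl

sumBelow-+ : ∀ n g h → sumBelow n (λ i → g i + h i) ≡ sumBelow n g + sumBelow n h
sumBelow-+ zero g h = refl
sumBelow-+ (suc n) g h rewrite sumBelow-+ n g h = interchange (sumBelow n g) (sumBelow n h) (g n) (h n)
  where
  interchange : ∀ (a b c d : ℤ) → (a + b) + (c + d) ≡ (a + c) + (b + d)
  interchange = solve-∀

sumBelow-sumOver : ∀ n (G : ℕ → List ℕ → ℤ) xs →
  sumBelow n (λ i → sumOver (G i) xs) ≡ sumOver (λ κ → sumBelow n (λ i → G i κ)) xs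
sumBelow-sumOver n G [] = sumBelow-0 n
sumBelow-sumOver n G (x ∷ xs) =
  trans (sumBelow-+ n (λ i → G i x) (λ i → sumOver (G i) xs))
        (cong (_+_ (sumBelow n (λ i → G i x))) (sumBelow-sumOver n G xs))

binomℤ-pascal : ∀ m z → + binomℤ (suc m) z ≡ + binomℤ m z + + binomℤ m (z - + 1)
binomℤ-pascal m (+ zero) = refl
binomℤ-pascal m (+ suc k) =
  trans (cong +_ (trans (sym (nCk+nC[k+1]≡[n+1]C[k+1] m k)) (ℕₚ.+-comm (m C k) _)))
        (ℤₚ.pos-+ (m C suc k) (m C k))
binomℤ-pascal m -[1+ k ] = refl

term : ℕ → ℤ → List ℕ → ℕ → ℤ
term M p μ i = sgn i * + binomℤ M (p + + i) * + fOneRow i μ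

RHS≡sumBelow : ∀ μ p {M} → p + + size μ ≡ + M → RHS μ p ≡ sumBelow (suc (size μ)) (term M p μ)
RHS≡sumBelow μ p e =
  trans (Σ0to≡sumBelow (size μ) _) (cong (λ M → sumBelow (suc (size μ)) (term M p μ)) (cong ℤ.∣_∣ e))

term-pascal : ∀ m p μ i → term (suc m) p μ i ≡ term m p μ i + term m (p - + 1) μ i
term-pascal m p μ i = begin
  sgn i * + binomℤ (suc m) (p + + i) * f
    ≡⟨ cong (λ b → sgn i * b * f) (binomℤ-pascal m (p + + i)) ⟩
  sgn i * (+ binomℤ m (p + + i) + + binomℤ m (p + + i - + 1)) * f
    ≡⟨ distrib (sgn i) _ _ f ⟩
  term m p μ i + sgn i * + binomℤ m (p + + i - + 1) * f
    ≡⟨ cong (λ z → term m p μ i + sgn i * + binomℤ m z * f) (shift p (+ i)) ⟩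
  term m p μ i + term m (p - + 1) μ i ∎
  where
  open ≡-Reasoning
  f = + fOneRow i μ
  distrib : ∀ (s a b f : ℤ) → s * (a + b) * f ≡ s * a * f + s * b * f
  distrib = solve-∀
  shift : ∀ (p i : ℤ) → p + i - + 1 ≡ (p - + 1) + i
  shift = solve-∀

predecessor-size : ∀ {κ μ} p {m} → κ ⋖ μ → p + + size μ ≡ + suc m → p + + size κ ≡ + m
predecessor-size {κ} {μ} p {m} κ⋖μ e = begin
  p + + size κ                ≡⟨ shift p (+ size κ) ⟩
  p + + suc (size κ) - + 1    ≡⟨ cong (λ s → p + + s - + 1) (_⋖_.size-suc κ⋖μ) ⟩
  p + + size μ - + 1          ≡⟨ cong (_- + 1) e ⟩
  + m ∎
  where
  open ≡-Reasoning
  shift : ∀ (p s : ℤ) → p + s ≡ p + (+ 1 + s) - + 1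
  shift = solve-∀

shift-size : ∀ p {n m} → p + + n ≡ + suc m → p - + 1 + + n ≡ + m
shift-size p {n} e = trans (shift p (+ n)) (cong (_- + 1) e)
  where
  shift : ∀ (p s : ℤ) → p - + 1 + s ≡ p + s - + 1
  shift = solve-∀

term-branching : ∀ {μ} p m → IsPartition μ → p + + size μ ≡ + suc m →
  sumBelow (suc (size μ)) (term m p μ) ≡ sumOver (λ κ → RHS κ p) (preds μ [])
term-branching {μ} p m P e = begin
  sumBelow n (term m p μ) + term m p μ n
    ≡⟨ cong (_+_ (sumBelow n (term m p μ))) top-vanishes ⟩
  sumBelow n (term m p μ) + + 0
    ≡⟨ ℤₚ.+-identityʳ _ ⟩
  sumBelow n (term m p μ)
    ≡⟨ sumBelow-cong n term-branched ⟩
  sumBelow n (λ i → sumOver (λ κ → term m p κ i) (preds μ []))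
    ≡⟨ sumBelow-sumOver n (λ i κ → term m p κ i) (preds μ []) ⟩
  sumOver (λ κ → sumBelow n (term m p κ)) (preds μ [])
    ≡⟨ sumOver-cong (All.map (λ κ⋖μ → sym (RHS-of-predecessor κ⋖μ)) (preds-⋖ P)) ⟩
  sumOver (λ κ → RHS κ p) (preds μ []) ∎
  where
  open ≡-Reasoning
  n = size μ
  c : ℕ → ℤ
  c i = sgn i * + binomℤ m (p + + i)
  -- p + n = m + 1, so the binomial in the top term is m choose m+1
  top-vanishes : term m p μ n ≡ + 0
  top-vanishes rewrite e | k>n⇒nCk≡0 {m} {suc m} (ℕₚ.n<1+n m) =
    trans (cong (_* + fOneRow n μ) (ℤₚ.*-zeroʳ (sgn n))) (ℤₚ.*-zeroˡ (+ fOneRow n μ))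
  term-branched : ∀ i → i ℕ.< n → term m p μ i ≡ sumOver (λ κ → term m p κ i) (preds μ [])
  term-branched i lt = begin
    c i * + fOneRow i μ
      ≡⟨ cong (λ z → c i * + z) (branching i P lt) ⟩
    c i * + sum (map (fOneRow i) (preds μ []))
      ≡⟨ cong (c i *_) (+sum≡sumOver (fOneRow i) (preds μ [])) ⟩
    c i * sumOver (λ κ → + fOneRow i κ) (preds μ [])
      ≡⟨ *-sumOver (c i) (λ κ → + fOneRow i κ) (preds μ []) ⟩
    sumOver (λ κ → c i * + fOneRow i κ) (preds μ []) ∎
  RHS-of-predecessor : ∀ {κ} → κ ⋖ μ → RHS κ p ≡ sumBelow n (term m p κ)
  RHS-of-predecessor {κ} κ⋖μ =
    subst (λ N → RHS κ p ≡ sumBelow N (term m p κ)) (_⋖_.size-suc κ⋖μ) (RHS≡sumBelow κ p (predecessor-size p κ⋖μ e))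

RHS-pascal : ∀ {μ} p m → IsPartition μ → p + + size μ ≡ + suc m →
  RHS μ p ≡ sumOver (λ κ → RHS κ p) (preds μ []) + RHS μ (p - + 1)
RHS-pascal {μ} p m P e = begin
  RHS μ p
    ≡⟨ RHS≡sumBelow μ p e ⟩
  sumBelow (suc n) (term (suc m) p μ)
    ≡⟨ sumBelow-cong (suc n) (λ i _ → term-pascal m p μ i) ⟩
  sumBelow (suc n) (λ i → term m p μ i + term m (p - + 1) μ i)
    ≡⟨ sumBelow-+ (suc n) (term m p μ) (term m (p - + 1) μ) ⟩
  sumBelow (suc n) (term m p μ) + sumBelow (suc n) (term m (p - + 1) μ)
    ≡⟨ cong₂ _+_ (term-branching p m P e) (sym (RHS≡sumBelow μ (p - + 1) (shift-size p e))) ⟩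
  sumOver (λ κ → RHS κ p) (preds μ []) + RHS μ (p - + 1) ∎
  where
  open ≡-Reasoning
  n = size μ

φ : List ℕ → ℕ → ℤ
φ μ L = + L - + row L μ

diff<diff : ∀ a b c d → a ℕ.+ d ℕ.< c ℕ.+ b → + a - + b ℤ.< + c - + d
diff<diff a b c d lt = subst₂ ℤ._<_ (cancel (+ a) (+ b) (+ d)) (cancel′ (+ c) (+ b) (+ d))
  (ℤₚ.+-monoʳ-< (ℤ.- (+ b + + d)) (subst₂ ℤ._<_ (ℤₚ.pos-+ a d) (ℤₚ.pos-+ c b) (ℤ.+<+ lt)))
  where
  cancel : ∀ a b d → ℤ.- (b + d) + (a + d) ≡ a - b
  cancel = solve-∀
  cancel′ : ∀ c b d → ℤ.- (b + d) + (c + b) ≡ c - d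
  cancel′ = solve-∀

diff<diff⁻¹ : ∀ a b c d → + a - + b ℤ.< + c - + d → a ℕ.+ d ℕ.< c ℕ.+ b
diff<diff⁻¹ a b c d lt = ℤₚ.drop‿+<+ (subst₂ ℤ._<_
  (trans (cancel (+ a) (+ b) (+ d)) (sym (ℤₚ.pos-+ a d))) (trans (cancel′ (+ c) (+ b) (+ d)) (sym (ℤₚ.pos-+ c b)))
  (ℤₚ.+-monoʳ-< (+ b + + d) lt))
  where
  cancel : ∀ a b d → (b + d) + (a - b) ≡ a + d
  cancel = solve-∀
  cancel′ : ∀ c b d → (b + d) + (c - d) ≡ c + b
  cancel′ = solve-∀

φ-< : ∀ {μ} → IsPartition μ → ∀ {L₁ L₂} → L₁ ℕ.< L₂ → φ μ L₁ ℤ.< φ μ L₂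
φ-< {μ} P {L₁} {L₂} lt = diff<diff L₁ (row L₁ μ) L₂ (row L₂ μ) (ℕₚ.+-mono-<-≤ lt (row-antitone P (ℕₚ.<⇒≤ lt)))

φ-≤ : ∀ {μ} → IsPartition μ → ∀ {L₁ L₂} → L₁ ℕ.≤ L₂ → φ μ L₁ ≤ φ μ L₂
φ-≤ P le with ℕₚ.m≤n⇒m<n∨m≡n le
... | inj₁ lt = ℤₚ.<⇒≤ (φ-< P lt)
... | inj₂ refl = ℤₚ.≤-refl

φ-injective : ∀ {μ} → IsPartition μ → ∀ {L₁ L₂} → φ μ L₁ ≡ φ μ L₂ → L₁ ≡ L₂
φ-injective P {L₁} {L₂} e with ℕₚ.<-cmp L₁ L₂
... | tri< lt _ _ = ⊥-elim (ℤₚ.<-irrefl e (φ-< P lt))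
... | tri≈ _ eq _ = eq
... | tri> _ _ gt = ⊥-elim (ℤₚ.<-irrefl (sym e) (φ-< P gt))

φ-suc : ∀ μ L → row L μ ≡ row (suc L) μ → φ μ (suc L) ≡ φ μ L + + 1
φ-suc μ L e rewrite e = shift (+ L) (+ row (suc L) μ)
  where
  shift : ∀ l r → (+ 1 + l) - r ≡ (l - r) + + 1
  shift = solve-∀

φ-suc-gap : ∀ μ L → row (suc L) μ ℕ.< row L μ → φ μ L + + 1 ℤ.< φ μ (suc L)
φ-suc-gap μ L lt = subst (ℤ._< φ μ (suc L)) (shift (+ L) (+ row L μ))
  (diff<diff (suc L) (row L μ) (suc L) (row (suc L) μ) (ℕₚ.+-monoʳ-< (suc L) lt))
  where
  shift : ∀ l r → (+ 1 + l) - r ≡ (l - r) + + 1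
  shift = solve-∀

φ-shorter-row : ∀ μ κ L → suc (row L κ) ≡ row L μ → φ κ L ≡ φ μ L + + 1
φ-shorter-row μ κ L e = trans (shift (+ L) (+ row L κ)) (cong (λ r → (+ L - + r) + + 1) e)
  where
  shift : ∀ l r → l - r ≡ (l - (+ 1 + r)) + + 1
  shift = solve-∀

φ-equal-row : ∀ μ κ L → row L κ ≡ row L μ → φ κ L ≡ φ μ L
φ-equal-row μ κ L e = cong (λ r → + L - + r) e

m≤∣m-n∣+n : ∀ m n → m ℕ.≤ ℤ.∣ + m - + n ∣ ℕ.+ n
m≤∣m-n∣+n m n with ℕₚ.≤-total n m
... | inj₁ n≤m rewrite ℤₚ.[+m]-[+n]≡m⊖n m n | ℤₚ.⊖-≥ n≤m = ℕₚ.≤-reflexive (sym (ℕₚ.m∸n+n≡m n≤m))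
... | inj₂ m≤n = ℕₚ.≤-trans m≤n (ℕₚ.m≤n+m n _)

φ⁻¹? : ∀ μ q → (Σ ℕ λ L → φ μ L ≡ q) ⊎ (∀ L → φ μ L ≢ q)
φ⁻¹? μ q with ℕₚ.anyUpTo? (λ L → φ μ L ℤₚ.≟ q) (suc (ℤ.∣ q ∣ ℕ.+ size μ))
... | yes (L , _ , e) = inj₁ (L , e)
... | no none = inj₂ λ L e → none (L , s≤s (bound L e) , e)
  where
  bound : ∀ L → φ μ L ≡ q → L ℕ.≤ ℤ.∣ q ∣ ℕ.+ size μ
  bound L refl = ℕₚ.≤-trans (m≤∣m-n∣+n L (row L μ)) (ℕₚ.+-monoʳ-≤ _ (row≤size L μ))

Ψ : ℕ → List ℕ → List ℕ
Ψ zero [] = []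
Ψ zero (_ ∷ xs) = xs
Ψ (suc L) [] = 1 ∷ Ψ L []
Ψ (suc L) (x ∷ xs) = suc x ∷ Ψ L xs

row0-Ψ-suc : ∀ L r → row 0 (Ψ (suc L) r) ≡ suc (row 0 r)
row0-Ψ-suc L [] = refl
row0-Ψ-suc L (x ∷ r) = refl

row0-Ψ-≤ : ∀ L xs → IsPartition xs → row 0 (Ψ L xs) ℕ.≤ suc (row 0 xs)
row0-Ψ-≤ zero [] P = z≤n
row0-Ψ-≤ zero (x ∷ xs) P = ℕₚ.m≤n⇒m≤1+n (second≤head P)
row0-Ψ-≤ (suc L) xs P = ℕₚ.≤-reflexive (row0-Ψ-suc L xs)

Ψ-isPartition : ∀ L {μ} → IsPartition μ → IsPartition (Ψ L μ)
Ψ-isPartition zero {[]} P = P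
Ψ-isPartition zero {x ∷ xs} P = tail-isPartition P
Ψ-isPartition (suc L) {[]} P = cons-isPartition (row0-Ψ-≤ L [] P) (s≤s z≤n) (Ψ-isPartition L P)
Ψ-isPartition (suc L) {x ∷ xs} P =
  cons-isPartition (ℕₚ.≤-trans (row0-Ψ-≤ L xs (tail-isPartition P)) (s≤s (second≤head P)))
                   (s≤s z≤n) (Ψ-isPartition L (tail-isPartition P))

size-Ψ : ∀ L μ → size (Ψ L μ) ℕ.+ row L μ ≡ size μ ℕ.+ L
size-Ψ zero [] = refl
size-Ψ zero (x ∷ xs) = trans (ℕₚ.+-comm (size xs) x) (sym (ℕₚ.+-identityʳ _))
size-Ψ (suc L) [] = cong suc (size-Ψ L [])
size-Ψ (suc L) (x ∷ xs) =
  trans (assoc x (size (Ψ L xs)) (row L xs)) (trans (cong (λ z → suc (x ℕ.+ z)) (size-Ψ L xs)) (assoc′ x (size xs) L))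
  where
  assoc : ∀ x s n → (suc x ℕ.+ s) ℕ.+ n ≡ suc (x ℕ.+ (s ℕ.+ n))
  assoc = ℕ-Solver.solve-∀
  assoc′ : ∀ x t L → suc (x ℕ.+ (t ℕ.+ L)) ≡ (x ℕ.+ t) ℕ.+ suc L
  assoc′ = ℕ-Solver.solve-∀

size-Ψ-φ : ∀ μ L {p m} → φ μ L ≡ p → p + + size μ ≡ + m → size (Ψ L μ) ≡ m
size-Ψ-φ μ L {p} {m} refl e = ℤₚ.+-injective (begin
  + size (Ψ L μ)                            ≡⟨ cancel (+ size (Ψ L μ)) (+ row L μ) ⟩
  (+ size (Ψ L μ) + + row L μ) - + row L μ  ≡⟨ cong (_- + row L μ) (sym (ℤₚ.pos-+ (size (Ψ L μ)) _)) ⟩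
  + (size (Ψ L μ) ℕ.+ row L μ) - + row L μ  ≡⟨ cong (λ z → + z - + row L μ) (size-Ψ L μ) ⟩
  + (size μ ℕ.+ L) - + row L μ              ≡⟨ cong (_- + row L μ) (ℤₚ.pos-+ (size μ) L) ⟩
  (+ size μ + + L) - + row L μ              ≡⟨ reorder (+ size μ) (+ L) (+ row L μ) ⟩
  φ μ L + + size μ                          ≡⟨ e ⟩
  + m ∎)
  where
  open ≡-Reasoning
  cancel : ∀ (x a : ℤ) → x ≡ (x + a) - a
  cancel = solve-∀
  reorder : ∀ (s l a : ℤ) → (s + l) - a ≡ (l - a) + s
  reorder = solve-∀

conj-Ψ-short : ∀ L {μ} → IsPartition μ → ∀ i → 1 ℕ.≤ i → i ℕ.≤ row L μ → suc (conj (Ψ L μ) i) ≡ conj μ i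
conj-Ψ-short L {[]} P i p le = ⊥-elim (ℕₚ.<-irrefl refl (ℕₚ.≤-trans p le))
conj-Ψ-short zero {x ∷ xs} P i p le = sym (conj-∷-≤ xs le)
conj-Ψ-short (suc L) {x ∷ xs} P i p le =
  trans (cong suc (conj-∷-≤ (Ψ L xs) (ℕₚ.m≤n⇒m≤1+n i≤x)))
        (trans (cong suc (conj-Ψ-short L (tail-isPartition P) i p le)) (sym (conj-∷-≤ xs i≤x)))
  where
  i≤x : i ℕ.≤ x
  i≤x = ℕₚ.≤-trans le (rows≤head P L)

conj-Ψ-new : ∀ L {μ} → IsPartition μ → conj (Ψ L μ) (suc (row L μ)) ≡ L
conj-Ψ-new zero {[]} P = refl
conj-Ψ-new zero {x ∷ xs} P = conj≡0 (suc x) (tail-isPartition P) (s≤s (second≤head P))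
conj-Ψ-new (suc L) {[]} P = cong suc (conj-Ψ-new L P)
conj-Ψ-new (suc L) {x ∷ xs} P rewrite conj-∷-≤ {suc (row L xs)} {suc x} (Ψ L xs) (s≤s (rows≤head P L)) =
  cong suc (conj-Ψ-new L (tail-isPartition P))

conj-Ψ-shifted : ∀ L {μ} → IsPartition μ → ∀ i → suc (suc (row L μ)) ℕ.≤ i → conj (Ψ L μ) i ≡ conj μ (i ℕ.∸ 1)
conj-Ψ-shifted zero {[]} P i le = refl
conj-Ψ-shifted zero {x ∷ xs} P (suc i) (s≤s le) rewrite conj-∷-≰ {i} {x} xs (ℕₚ.<⇒≱ le) =
  trans (conj≡0 (suc i) (tail-isPartition P) (ℕₚ.≤-<-trans (second≤head P) (ℕₚ.m<n⇒m<1+n le)))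
        (sym (conj≡0 i (tail-isPartition P) (ℕₚ.≤-<-trans (second≤head P) le)))
conj-Ψ-shifted (suc L) {[]} P (suc (suc i)) le = conj-Ψ-shifted L P (suc (suc i)) le
conj-Ψ-shifted (suc L) {[]} P (suc zero) (s≤s ())
conj-Ψ-shifted (suc L) {x ∷ xs} P (suc i) le with i ℕ.≤? x
... | yes i≤x rewrite conj-∷-≤ {suc i} {suc x} (Ψ L xs) (s≤s i≤x) | conj-∷-≤ {i} {x} xs i≤x =
  cong suc (conj-Ψ-shifted L (tail-isPartition P) (suc i) le)
... | no i≰x rewrite conj-∷-≰ {suc i} {suc x} (Ψ L xs) (λ q → i≰x (ℕₚ.≤-pred q)) | conj-∷-≰ {i} {x} xs i≰x =
  conj-Ψ-shifted L (tail-isPartition P) (suc i) le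

colP-< : ∀ μ p {a i} → i ℕ.< a → colP μ p a i ≡ + conj μ i - + 1
colP-< μ p lt rewrite <ᵇ≡true lt = refl

colP-≡ : ∀ μ p a → colP μ p a a ≡ p + + a - + 1
colP-≡ μ p a rewrite <ᵇ≡false {a} {a} ℕₚ.≤-refl | ≡ᵇ≡true {a} {a} refl = refl

colP-> : ∀ μ p {a i} → a ℕ.< i → colP μ p a i ≡ + conj μ (i ℕ.∸ 1)
colP-> μ p {a} {i} gt rewrite <ᵇ≡false {i} {a} (ℕₚ.<⇒≤ gt) | ≡ᵇ≡false {i} {a} (ℕₚ.>⇒≢ gt) = refl

Ψ-hasColumns : ∀ {μ} L {p} → IsPartition μ → φ μ L ≡ p → HasColumns (Ψ L μ) (colP μ p (suc (row L μ)))
Ψ-hasColumns {μ} L {p} P refl = Ψ-isPartition L P , columns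
  where
  a = suc (row L μ)
  columns : ∀ i → 1 ℕ.≤ i → + conj (Ψ L μ) i ≡ colP μ p a i
  columns i 1≤i with ℕₚ.<-cmp i a
  ... | tri< lt _ _ = trans (unshift (+ conj (Ψ L μ) i))
    (trans (cong (λ z → + z - + 1) (conj-Ψ-short L P i 1≤i (ℕₚ.≤-pred lt))) (sym (colP-< μ p lt)))
    where
    unshift : ∀ x → x ≡ (+ 1 + x) - + 1
    unshift = solve-∀
  ... | tri≈ _ refl _ = trans (cong +_ (conj-Ψ-new L P)) (trans (unshift (+ L) (+ row L μ)) (sym (colP-≡ μ p a)))
    where
    unshift : ∀ l n → l ≡ ((l - n) + (+ 1 + n)) - + 1
    unshift = solve-∀
  ... | tri> _ _ gt = trans (cong +_ (conj-Ψ-shifted L P i gt)) (sym (colP-> μ p gt))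

predsOff : ℕ → List ℕ → List (List ℕ)
predsOff L [] = []
predsOff zero (x ∷ rest) = map (x ∷_) (preds rest [])
predsOff (suc L) (x ∷ rest) = corners x rest ++ map (x ∷_) (predsOff L rest)

predsAt : ℕ → List ℕ → List (List ℕ)
predsAt L [] = []
predsAt zero (x ∷ rest) = corners x rest
predsAt (suc L) (x ∷ rest) = map (x ∷_) (predsAt L rest)

sumOver-predsOff-suc : ∀ g L x rest → sumOver g (predsOff (suc L) (x ∷ rest)) ≡
  cornerTerm g x rest + sumOver (λ κ → g (x ∷ κ)) (predsOff L rest)
sumOver-predsOff-suc g L x rest =
  trans (sumOver-++ g (corners x rest) _)
        (cong₂ _+_ (sumOver-corners g x rest) (sumOver-map g (x ∷_) (predsOff L rest)))

sumOver-preds-split : ∀ g L μ → sumOver g (preds μ []) ≡ sumOver g (predsOff L μ) + sumOver g (predsAt L μ)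
sumOver-preds-split g L [] = refl
sumOver-preds-split g zero (x ∷ rest) =
  trans (sumOver-preds-[] g x rest)
        (trans (ℤₚ.+-comm (cornerTerm g x rest) _) (cong₂ _+_ (sym (sumOver-map g (x ∷_) (preds rest []))) (sym (sumOver-corners g x rest))))
sumOver-preds-split g (suc L) (x ∷ rest) = begin
  sumOver g (preds (x ∷ rest) [])
    ≡⟨ sumOver-preds-[] g x rest ⟩
  c + sumOver g′ (preds rest [])
    ≡⟨ cong (_+_ c) (sumOver-preds-split g′ L rest) ⟩
  c + (sumOver g′ (predsOff L rest) + sumOver g′ (predsAt L rest))
    ≡⟨ sym (ℤₚ.+-assoc c _ _) ⟩
  (c + sumOver g′ (predsOff L rest)) + sumOver g′ (predsAt L rest)
    ≡⟨ cong₂ _+_ (sym (sumOver-predsOff-suc g L x rest)) (sym (sumOver-map g (x ∷_) (predsAt L rest))) ⟩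
  sumOver g (predsOff (suc L) (x ∷ rest)) + sumOver g (predsAt (suc L) (x ∷ rest)) ∎
  where
  open ≡-Reasoning
  c = cornerTerm g x rest
  g′ = λ κ → g (x ∷ κ)

All-preds-split : ∀ {P : List ℕ → Set} L μ → All P (preds μ []) → All P (predsOff L μ) × All P (predsAt L μ)
All-preds-split L [] _ = [] , []
All-preds-split zero (x ∷ rest) a rewrite preds-[] x rest = ++⁻ʳ (corners x rest) a , ++⁻ˡ (corners x rest) a
All-preds-split (suc L) (x ∷ rest) a rewrite preds-[] x rest
  with All-preds-split L rest (map⁻ (++⁻ʳ (corners x rest) a))
... | off , at = ++⁺ (++⁻ˡ (corners x rest) a) (map⁺ off) , map⁺ at

predsOff-row : ∀ L {μ} → IsPartition μ → All (λ κ → row L κ ≡ row L μ) (predsOff L μ)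
predsOff-row L {[]} P = []
predsOff-row zero {x ∷ rest} P = map⁺ (All.tabulate (λ _ → refl))
predsOff-row (suc L) {x ∷ rest} P =
  ++⁺ (All-corners x rest (corner-row x P)) (map⁺ (predsOff-row L (tail-isPartition P)))
  where
  corner-row : ∀ x → IsPartition (x ∷ rest) → T (row 0 rest ℕ.<ᵇ x) → row (suc L) (dropBox x rest) ≡ row L rest
  corner-row zero P t = ⊥-elim (ℕₚ.<-irrefl refl (head-positive P))
  corner-row (suc zero) P t with rest≡[] P t
  ... | refl = refl
  corner-row (suc (suc y)) P t = refl

record RemovedFromRow (L : ℕ) (μ κ : List ℕ) : Set where
  field
    other-rows : ∀ i → i ≢ L → row i κ ≡ row i μ
    shorter    : suc (row L κ) ≡ row L μ
    same-Ψ     : Ψ L κ ≡ Ψ L μ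

predsAt-removed : ∀ L {μ} → IsPartition μ → All (RemovedFromRow L μ) (predsAt L μ)
predsAt-removed L {[]} P = []
predsAt-removed zero {x ∷ rest} P = All-corners x rest (removed x P)
  where
  removed : ∀ x → IsPartition (x ∷ rest) → T (row 0 rest ℕ.<ᵇ x) → RemovedFromRow zero (x ∷ rest) (dropBox x rest)
  removed zero P t = ⊥-elim (ℕₚ.<-irrefl refl (head-positive P))
  removed (suc zero) P t with rest≡[] P t
  ... | refl = record { other-rows = λ { zero ne → ⊥-elim (ne refl) ; (suc i) _ → refl } ; shorter = refl ; same-Ψ = refl }
  removed (suc (suc y)) P t =
    record { other-rows = λ { zero ne → ⊥-elim (ne refl) ; (suc i) _ → refl } ; shorter = refl ; same-Ψ = refl }
predsAt-removed (suc L) {x ∷ rest} P = map⁺ (All.map extend (predsAt-removed L (tail-isPartition P)))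
  where
  extend : ∀ {κ} → RemovedFromRow L rest κ → RemovedFromRow (suc L) (x ∷ rest) (x ∷ κ)
  extend r = record
    { other-rows = λ { zero _ → refl ; (suc i) ne → other-rows i (λ q → ne (cong suc q)) }
    ; shorter = shorter
    ; same-Ψ = cong (suc x ∷_) same-Ψ }
    where open RemovedFromRow r

predsAt-single : ∀ L μ → row (suc L) μ ℕ.< row L μ → Σ (List ℕ) λ κ → predsAt L μ ≡ κ ∷ []
predsAt-single zero (x ∷ rest) lt rewrite <ᵇ≡true lt = dropBox x rest , refl
predsAt-single (suc L) (x ∷ rest) lt with predsAt-single L rest lt
... | κ , e = x ∷ κ , cong (map (x ∷_)) e

-- When rows L and L+1 of μ have equal length, removing the end of row L from Ψ (suc L) μ
-- gives Ψ L μ; this is the only corner of Ψ (suc L) μ not coming from a corner of μ.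
extraCorner : (List ℕ → ℤ) → ℕ → List ℕ → ℤ
extraCorner g zero μ = + 0
extraCorner g (suc L) μ = if row L μ ℕ.≡ᵇ row (suc L) μ then g (Ψ L μ) else + 0

cornerTerm-Ψ-suc : ∀ g L x rest → IsPartition (x ∷ rest) →
  cornerTerm g (suc x) (Ψ (suc L) rest) ≡ cornerTerm (λ κ → g (Ψ (suc (suc L)) κ)) x rest
cornerTerm-Ψ-suc g L x rest P with row 0 rest ℕ.<ᵇ x in lt
... | false rewrite row0-Ψ-suc L rest | lt = refl
... | true rewrite row0-Ψ-suc L rest | lt = cong g (dropBox-Ψ x P (subst T (sym lt) _))
  where
  dropBox-Ψ : ∀ x → IsPartition (x ∷ rest) → T (row 0 rest ℕ.<ᵇ x) →
              dropBox (suc x) (Ψ (suc L) rest) ≡ Ψ (suc (suc L)) (dropBox x rest)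
  dropBox-Ψ zero P t = ⊥-elim (ℕₚ.<-irrefl refl (head-positive P))
  dropBox-Ψ (suc zero) P t with rest≡[] P t
  ... | refl = refl
  dropBox-Ψ (suc (suc y)) P t = refl

cornerTerm-Ψ-zero : ∀ g x rest → IsPartition (x ∷ rest) →
  cornerTerm g (suc x) (Ψ zero rest) ≡ cornerTerm (λ κ → g (Ψ 1 κ)) x rest + extraCorner g 1 (x ∷ rest)
cornerTerm-Ψ-zero g zero rest P = ⊥-elim (ℕₚ.<-irrefl refl (head-positive P))
cornerTerm-Ψ-zero g (suc zero) [] P = sym (ℤₚ.+-identityʳ _)
cornerTerm-Ψ-zero g (suc (suc y)) [] P = sym (ℤₚ.+-identityʳ _)
cornerTerm-Ψ-zero g (suc x) (y ∷ ys) P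
  rewrite <ᵇ≡true {row 0 ys} {suc (suc x)} (s≤s (ℕₚ.≤-trans (second≤head (tail-isPartition P)) (second≤head P)))
  with y ℕ.≟ suc x
... | yes refl rewrite <ᵇ≡false {suc x} {suc x} ℕₚ.≤-refl | ≡ᵇ≡true {suc x} {suc x} refl =
  sym (ℤₚ.+-identityˡ _)
... | no y≢x rewrite <ᵇ≡true (ℕₚ.≤∧≢⇒< (second≤head P) y≢x) | ≡ᵇ≡false {suc x} {y} (y≢x ∘ sym) =
  trans (cong g (dropBox-Ψ x (head-positive (tail-isPartition P)) (ℕₚ.≤∧≢⇒< (second≤head P) y≢x)))
        (sym (ℤₚ.+-identityʳ _))
  where
  dropBox-Ψ : ∀ x → 1 ℕ.≤ y → y ℕ.< suc x → suc x ∷ ys ≡ Ψ 1 (dropBox (suc x) (y ∷ ys))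
  dropBox-Ψ zero p lt = ⊥-elim (ℕₚ.<-irrefl refl (ℕₚ.≤-trans lt p))
  dropBox-Ψ (suc z) p lt = refl

Ψ-corners : ∀ L μ g → IsPartition μ →
  sumOver g (preds (Ψ L μ) []) ≡ sumOver (λ κ → g (Ψ L κ)) (predsOff L μ) + extraCorner g L μ
Ψ-corners zero [] g P = refl
Ψ-corners zero (x ∷ rest) g P = sym (trans (ℤₚ.+-identityʳ _) (sumOver-map (λ κ → g (Ψ zero κ)) (x ∷_) (preds rest [])))
Ψ-corners (suc zero) [] g P = trans (ℤₚ.+-identityʳ (g [])) (sym (ℤₚ.+-identityˡ (g [])))
Ψ-corners (suc (suc L)) [] g P =
  trans (sumOver-map g (1 ∷_) (preds (Ψ (suc L) []) [])) (Ψ-corners (suc L) [] (λ κ → g (1 ∷ κ)) P)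
Ψ-corners (suc L) (x ∷ rest) g P = begin
  sumOver g (preds (suc x ∷ Ψ L rest) [])
    ≡⟨ sumOver-preds-[] g (suc x) (Ψ L rest) ⟩
  A + sumOver g′ (preds (Ψ L rest) [])
    ≡⟨ cong (_+_ A) (Ψ-corners L rest g′ (tail-isPartition P)) ⟩
  A + (S + extraCorner g′ L rest)
    ≡⟨ swap A S _ ⟩
  (A + extraCorner g′ L rest) + S
    ≡⟨ cong (_+ S) (corner-shift L) ⟩
  (A′ + extraCorner g (suc L) (x ∷ rest)) + S
    ≡⟨ swap′ A′ S _ ⟩
  (A′ + S) + extraCorner g (suc L) (x ∷ rest)
    ≡⟨ cong (_+ extraCorner g (suc L) (x ∷ rest)) (sym (sumOver-predsOff-suc (λ κ → g (Ψ (suc L) κ)) L x rest)) ⟩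
  sumOver (λ κ → g (Ψ (suc L) κ)) (predsOff (suc L) (x ∷ rest)) + extraCorner g (suc L) (x ∷ rest) ∎
  where
  open ≡-Reasoning
  g′ = λ κ → g (suc x ∷ κ)
  A = cornerTerm g (suc x) (Ψ L rest)
  A′ = cornerTerm (λ κ → g (Ψ (suc L) κ)) x rest
  S = sumOver (λ κ → g′ (Ψ L κ)) (predsOff L rest)
  swap : ∀ (a s e : ℤ) → a + (s + e) ≡ (a + e) + s
  swap = solve-∀
  swap′ : ∀ (a s e : ℤ) → (a + e) + s ≡ (a + s) + e
  swap′ = solve-∀
  corner-shift : ∀ L → cornerTerm g (suc x) (Ψ L rest) + extraCorner g′ L rest ≡
                       cornerTerm (λ κ → g (Ψ (suc L) κ)) x rest + extraCorner g (suc L) (x ∷ rest)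
  corner-shift zero = trans (ℤₚ.+-identityʳ _) (cornerTerm-Ψ-zero g x rest P)
  corner-shift (suc L) = cong (_+ extraCorner g′ (suc L) rest) (cornerTerm-Ψ-suc g L x rest P)

sgn-suc : ∀ k → sgn (suc k) ≡ ℤ.- sgn k
sgn-suc k = ℤₚ.-1*i≡-i (sgn k)

sgn-cancel : ∀ k (f : ℤ) → sgn k * f + sgn (suc k) * f ≡ + 0
sgn-cancel k f rewrite sgn-suc k = cancel (sgn k) f
  where
  cancel : ∀ (s f : ℤ) → s * f + (ℤ.- s) * f ≡ + 0
  cancel = solve-∀

sgn-suc-suc : ∀ k → sgn (suc (suc k)) ≡ sgn k
sgn-suc-suc k rewrite sgn-suc (suc k) | sgn-suc k = ℤₚ.neg-involutive (sgn k)

+1≡⇒≡-1 : ∀ {a p} → a + + 1 ≡ p → a ≡ p - + 1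
+1≡⇒≡-1 {a} refl = cancel a
  where
  cancel : ∀ a → a ≡ a + + 1 - + 1
  cancel = solve-∀

≡-1⇒+1≡ : ∀ {a p} → a ≡ p - + 1 → a + + 1 ≡ p
≡-1⇒+1≡ {p = p} refl = cancel p
  where
  cancel : ∀ p → p - + 1 + + 1 ≡ p
  cancel = solve-∀

p≰p-1 : ∀ p → ¬ p ≤ p - + 1
p≰p-1 p le = ℤₚ.<-irrefl refl (ℤₚ.i≤pred[j]⇒i<j (subst (p ≤_) (ℤₚ.+-comm p (ℤ.- + 1)) le))

p≢p-1 : ∀ p → p ≢ p - + 1
p≢p-1 p e = p≰p-1 p (ℤₚ.≤-reflexive e)

φ-⋖ : ∀ {κ μ} → κ ⋖ μ → ∀ L → φ κ L ≡ φ μ L ⊎ φ κ L ≡ φ μ L + + 1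
φ-⋖ {κ} {μ} κ⋖μ L with _⋖_.rows κ⋖μ L
... | inj₁ e = inj₁ (φ-equal-row μ κ L e)
... | inj₂ e = inj₂ (φ-shorter-row μ κ L e)

record RowFormula (μ : List ℕ) (p : ℤ) : Set where
  field
    at-φ  : ∀ L → φ μ L ≡ p → RHS μ p ≡ sgn (row L μ) * + fStraight (Ψ L μ)
    off-φ : (∀ L → φ μ L ≢ p) → RHS μ p ≡ + 0

chains-zero-≡ : ∀ ν → chains 0 ν ν ≡ 1
chains-zero-≡ ν rewrite dec-true (≡-dec ℕₚ._≟_ ν ν) refl = refl

chains-zero-≢ : ∀ {λ′ ν} → λ′ ≢ ν → chains 0 λ′ ν ≡ 0
chains-zero-≢ {λ′} {ν} ne rewrite dec-false (≡-dec ℕₚ._≟_ λ′ ν) ne = refl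

row0≡size⇒oneRow : ∀ {μ} → IsPartition μ → row 0 μ ≡ size μ → μ ≡ oneRow (size μ)
row0≡size⇒oneRow {[]} _ _ = refl
row0≡size⇒oneRow {x ∷ xs} P e
  with size≡0⇒[] (tail-isPartition P) (ℕₚ.+-cancelˡ-≡ x (size xs) 0 (trans (sym e) (sym (ℕₚ.+-identityʳ x))))
row0≡size⇒oneRow {zero ∷ _} P e | refl = ⊥-elim (ℕₚ.<-irrefl refl (head-positive P))
row0≡size⇒oneRow {suc y ∷ _} P e | refl = cong (λ z → suc z ∷ []) (sym (ℕₚ.+-identityʳ y))

row0-oneRow : ∀ n → row 0 (oneRow n) ≡ n
row0-oneRow zero = refl
row0-oneRow (suc n) = refl

Ψ0-oneRow : ∀ n → Ψ 0 (oneRow n) ≡ []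
Ψ0-oneRow zero = refl
Ψ0-oneRow (suc n) = refl

module _ {μ p} (P : IsPartition μ) (e : p + + size μ ≡ + 0) where

  private
    n = size μ

  -- Only the i = |μ| summand survives: p + i < 0 for i < |μ|, and the binomial is (0 choose 0) at i = |μ|.
  RHS-base : RHS μ p ≡ sgn n * + chains 0 μ (oneRow n)
  RHS-base = begin
    RHS μ p
      ≡⟨ RHS≡sumBelow μ p e ⟩
    sumBelow n (term 0 p μ) + term 0 p μ n
      ≡⟨ cong (_+ term 0 p μ n) (trans (sumBelow-cong n low) (sumBelow-0 n)) ⟩
    + 0 + term 0 p μ n
      ≡⟨ ℤₚ.+-identityˡ _ ⟩
    sgn n * + binomℤ 0 (p + + n) * + fOneRow n μ
      ≡⟨ cong (λ z → sgn n * + binomℤ 0 z * + fOneRow n μ) e ⟩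
    sgn n * + 1 * + fOneRow n μ
      ≡⟨ cong (_* + fOneRow n μ) (ℤₚ.*-identityʳ (sgn n)) ⟩
    sgn n * + fOneRow n μ
      ≡⟨ cong (λ z → sgn n * + z) (fOneRow≡chains n 0 μ (sym (ℕₚ.+-identityʳ n))) ⟩
    sgn n * + chains 0 μ (oneRow n) ∎
    where
    open ≡-Reasoning
    negative : ∀ i o → n ≡ i ℕ.+ suc o → p + + i ≡ -[1+ o ]
    negative i o n≡ = begin
      p + + i                            ≡⟨ shift p (+ i) (+ suc o) ⟩
      p + (+ i + + suc o) - + suc o      ≡⟨ cong (λ z → p + z - + suc o) (sym (ℤₚ.pos-+ i (suc o))) ⟩
      p + + (i ℕ.+ suc o) - + suc o      ≡⟨ cong (λ z → p + + z - + suc o) (sym n≡) ⟩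
      p + + n - + suc o                  ≡⟨ cong (_- + suc o) e ⟩
      -[1+ o ] ∎
      where
      shift : ∀ (p a b : ℤ) → p + a ≡ p + (a + b) - b
      shift = solve-∀
    low : ∀ i → i ℕ.< n → term 0 p μ i ≡ + 0
    low i lt with ℕₚ.m≤n⇒∃[o]m+o≡n lt
    ... | o , s = begin
      sgn i * + binomℤ 0 (p + + i) * + fOneRow i μ
        ≡⟨ cong (λ z → sgn i * + binomℤ 0 z * + fOneRow i μ) (negative i o (trans (sym s) (sym (ℕₚ.+-suc i o)))) ⟩
      sgn i * + 0 * + fOneRow i μ
        ≡⟨ cong (_* + fOneRow i μ) (ℤₚ.*-zeroʳ (sgn i)) ⟩
      + 0 * + fOneRow i μ
        ≡⟨ ℤₚ.*-zeroˡ (+ fOneRow i μ) ⟩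
      + 0 ∎

  φ≡p⇒oneRow : ∀ L → φ μ L ≡ p → L ≡ 0 × μ ≡ oneRow n
  φ≡p⇒oneRow L refl = L≡0 , row0≡size⇒oneRow P (subst (λ l → row l μ ≡ l ℕ.+ n) L≡0 (sym L+n≡row))
    where
    L+n≡row : L ℕ.+ n ≡ row L μ
    L+n≡row = ℤₚ.+-injective (begin
      + (L ℕ.+ n)                     ≡⟨ ℤₚ.pos-+ L n ⟩
      + L + + n                       ≡⟨ shift (+ L) (+ row L μ) (+ n) ⟩
      φ μ L + + n + + row L μ         ≡⟨ cong (_+ + row L μ) e ⟩
      + 0 + + row L μ                 ≡⟨ ℤₚ.+-identityˡ _ ⟩
      + row L μ ∎)
      where
      open ≡-Reasoning
      shift : ∀ (l r n : ℤ) → l + n ≡ (l - r) + n + r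
      shift = solve-∀
    L≡0 : L ≡ 0
    L≡0 = ℕₚ.n≤0⇒n≡0 (ℕₚ.+-cancelʳ-≤ n L 0 (subst (ℕ._≤ n) (sym L+n≡row) (row≤size L μ)))

  rowFormula-base : RowFormula μ p
  rowFormula-base = record { at-φ = at ; off-φ = off }
    where
    at : ∀ L → φ μ L ≡ p → RHS μ p ≡ sgn (row L μ) * + fStraight (Ψ L μ)
    at L eL with φ≡p⇒oneRow L eL
    ... | refl , μ≡ = begin
      RHS μ p
        ≡⟨ RHS-base ⟩
      sgn n * + chains 0 μ (oneRow n)
        ≡⟨ cong (λ κ → sgn n * + chains 0 κ (oneRow n)) μ≡ ⟩
      sgn n * + chains 0 (oneRow n) (oneRow n)
        ≡⟨ cong (λ z → sgn n * + z) (chains-zero-≡ (oneRow n)) ⟩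
      sgn n * + 1
        ≡⟨ cong₂ (λ r κ → sgn r * + fStraight κ) (sym (row0-oneRow n)) (sym (Ψ0-oneRow n)) ⟩
      sgn (row 0 (oneRow n)) * + fStraight (Ψ 0 (oneRow n))
        ≡⟨ cong (λ κ → sgn (row 0 κ) * + fStraight (Ψ 0 κ)) (sym μ≡) ⟩
      sgn (row 0 μ) * + fStraight (Ψ 0 μ) ∎
      where open ≡-Reasoning
    off : (∀ L → φ μ L ≢ p) → RHS μ p ≡ + 0
    off nf = trans RHS-base (trans (cong (λ z → sgn n * + z) (chains-zero-≢ μ≢oneRow)) (ℤₚ.*-zeroʳ (sgn n)))
      where
      μ≢oneRow : μ ≢ oneRow n
      μ≢oneRow μ≡ = nf 0 (begin
        + 0 - + row 0 μ          ≡⟨ cong (λ κ → + 0 - + row 0 κ) μ≡ ⟩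
        + 0 - + row 0 (oneRow n) ≡⟨ cong (λ r → + 0 - + r) (row0-oneRow n) ⟩
        + 0 - + n                ≡⟨ shift p (+ n) ⟩
        p - (p + + n)            ≡⟨ cong (p -_) e ⟩
        p - + 0                  ≡⟨ ℤₚ.+-identityʳ p ⟩
        p ∎)
        where
        open ≡-Reasoning
        shift : ∀ (p n : ℤ) → + 0 - n ≡ p - (p + n)
        shift = solve-∀

p+1≢p : ∀ p → p + + 1 ≢ p
p+1≢p p e = ℤₚ.i≢suc[i] (sym (trans (ℤₚ.+-comm (+ 1) p) e))

fStraight-branching : ∀ {ν} → IsPartition ν → 0 ℕ.< size ν →
  + fStraight ν ≡ sumOver (λ κ → + fStraight κ) (preds ν [])
fStraight-branching {ν} P lt = trans (cong +_ (branching 0 P lt)) (+sum≡sumOver fStraight (preds ν []))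

module _ {μ p m} (P : IsPartition μ) (e : p + + size μ ≡ + suc m)
         (IH-pred : ∀ {κ} → κ ⋖ μ → RowFormula κ p) (IH-shift : RowFormula μ (p - + 1)) where

  private
    R : List ℕ → ℤ
    R κ = RHS κ p
    open RowFormula

  RHS-shift-at : ∀ L → φ μ L ≡ p → RHS μ (p - + 1) ≡ extraCorner (λ κ → sgn (row L μ) * + fStraight κ) L μ
  RHS-shift-at zero eL = off-φ IH-shift λ L′ e′ → p≰p-1 p (subst₂ _≤_ eL e′ (φ-≤ P z≤n))
  RHS-shift-at (suc L₀) eL with row L₀ μ ℕ.≟ row (suc L₀) μ
  ... | yes same rewrite ≡ᵇ≡true same =
    trans (at-φ IH-shift L₀ (+1≡⇒≡-1 (trans (sym (φ-suc μ L₀ same)) eL)))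
          (cong (λ r → sgn r * + fStraight (Ψ L₀ μ)) same)
  ... | no differ rewrite ≡ᵇ≡false differ = off-φ IH-shift λ L′ e′ → below-gap L′ (≡-1⇒+1≡ e′)
    where
    -- p − 1 falls strictly between φ μ L₀ and φ μ (L₀ + 1) = p.
    below-gap : ∀ L′ → φ μ L′ + + 1 ≢ p
    below-gap L′ e′ with ℕₚ.≤-<-connex L′ L₀
    ... | inj₁ L′≤L₀ = ℤₚ.<-irrefl (trans e′ (sym eL))
      (ℤₚ.≤-<-trans (ℤₚ.+-monoˡ-≤ (+ 1) (φ-≤ P L′≤L₀))
                    (φ-suc-gap μ L₀ (ℕₚ.≤∧≢⇒< (row-suc-≤ P L₀) (differ ∘ sym))))
    ... | inj₂ L₀<L′ = p≰p-1 p (subst₂ _≤_ eL (+1≡⇒≡-1 e′) (φ-≤ P L₀<L′))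

  predsOff-RHS : ∀ L → φ μ L ≡ p →
    sumOver R (predsOff L μ) ≡ sumOver (λ κ → sgn (row L μ) * + fStraight (Ψ L κ)) (predsOff L μ)
  predsOff-RHS L eL = sumOver-cong (All.zipWith
    (λ { {κ} (κ⋖μ , same) → trans (at-φ (IH-pred κ⋖μ) L (trans (φ-equal-row μ κ L same) eL))
                                   (cong (λ r → sgn r * + fStraight (Ψ L κ)) same) })
    (proj₁ (All-preds-split L μ (preds-⋖ P)) , predsOff-row L P))

  predsAt-RHS≡0 : ∀ L → φ μ L ≡ p → sumOver R (predsAt L μ) ≡ + 0
  predsAt-RHS≡0 L eL = sumOver-≡0 (All.zipWith (λ (κ⋖μ , r) → off-φ (IH-pred κ⋖μ) (p∉φ r))
    (proj₂ (All-preds-split L μ (preds-⋖ P)) , predsAt-removed L P))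
    where
    p∉φ : ∀ {κ} → RemovedFromRow L μ κ → ∀ L′ → φ κ L′ ≢ p
    p∉φ {κ} r L′ e′ with L′ ℕ.≟ L
    ... | yes refl = p+1≢p p (trans (cong (_+ + 1) (sym eL)) (trans (sym (φ-shorter-row μ κ L shorter)) e′))
      where open RemovedFromRow r
    ... | no L′≢L = L′≢L (φ-injective P (trans (sym (φ-equal-row μ κ L′ (other-rows L′ L′≢L))) (trans e′ (sym eL))))
      where open RemovedFromRow r

  rowFormula-step-at : ∀ L → φ μ L ≡ p → RHS μ p ≡ sgn (row L μ) * + fStraight (Ψ L μ)
  rowFormula-step-at L eL = begin
    RHS μ p
      ≡⟨ RHS-pascal p m P e ⟩
    sumOver R (preds μ []) + RHS μ (p - + 1)
      ≡⟨ cong₂ _+_ (sumOver-preds-split R L μ) (RHS-shift-at L eL) ⟩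
    (sumOver R (predsOff L μ) + sumOver R (predsAt L μ)) + extraCorner h L μ
      ≡⟨ cong (_+ extraCorner h L μ) (cong₂ _+_ (predsOff-RHS L eL) (predsAt-RHS≡0 L eL)) ⟩
    (sumOver (λ κ → h (Ψ L κ)) (predsOff L μ) + + 0) + extraCorner h L μ
      ≡⟨ cong (_+ extraCorner h L μ) (ℤₚ.+-identityʳ (sumOver (λ κ → h (Ψ L κ)) (predsOff L μ))) ⟩
    sumOver (λ κ → h (Ψ L κ)) (predsOff L μ) + extraCorner h L μ
      ≡⟨ sym (Ψ-corners L μ h P) ⟩
    sumOver h (preds (Ψ L μ) [])
      ≡⟨ sym (*-sumOver s (λ κ → + fStraight κ) (preds (Ψ L μ) [])) ⟩
    s * sumOver (λ κ → + fStraight κ) (preds (Ψ L μ) [])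
      ≡⟨ cong (s *_) (sym (fStraight-branching (Ψ-isPartition L P) Ψ-nonempty)) ⟩
    s * + fStraight (Ψ L μ) ∎
    where
    open ≡-Reasoning
    s = sgn (row L μ)
    h : List ℕ → ℤ
    h κ = s * + fStraight κ
    Ψ-nonempty : 0 ℕ.< size (Ψ L μ)
    Ψ-nonempty = subst (0 ℕ.<_) (sym (size-Ψ-φ μ L eL e)) (s≤s z≤n)

  private
    p∉φ-pred : (∀ L → φ μ L ≢ p) → ∀ {κ} → κ ⋖ μ → ∀ L → φ κ L ≡ p → φ μ L ≡ p - + 1
    p∉φ-pred nf κ⋖μ L e′ with φ-⋖ κ⋖μ L
    ... | inj₁ same = ⊥-elim (nf L (trans (sym same) e′))
    ... | inj₂ up = +1≡⇒≡-1 (trans (sym up) e′)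

  rowFormula-step-off-both : (∀ L → φ μ L ≢ p) → (∀ L → φ μ L ≢ p - + 1) → RHS μ p ≡ + 0
  rowFormula-step-off-both nf nf′ = begin
    RHS μ p                                    ≡⟨ RHS-pascal p m P e ⟩
    sumOver R (preds μ []) + RHS μ (p - + 1)   ≡⟨ cong₂ _+_ (sumOver-≡0 (All.map vanishes (preds-⋖ P))) (off-φ IH-shift nf′) ⟩
    + 0 ∎
    where
    open ≡-Reasoning
    vanishes : ∀ {κ} → κ ⋖ μ → R κ ≡ + 0
    vanishes κ⋖μ = off-φ (IH-pred κ⋖μ) λ L e′ → nf′ L (p∉φ-pred nf κ⋖μ L e′)

  predsOff-RHS≡0 : (∀ L → φ μ L ≢ p) → ∀ L → φ μ L ≡ p - + 1 → sumOver R (predsOff L μ) ≡ + 0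
  predsOff-RHS≡0 nf L eL = sumOver-≡0 (All.zipWith (λ (κ⋖μ , same) → vanishes κ⋖μ same)
    (proj₁ (All-preds-split L μ (preds-⋖ P)) , predsOff-row L P))
    where
    open ≡-Reasoning
    vanishes : ∀ {κ} → κ ⋖ μ → row L κ ≡ row L μ → R κ ≡ + 0
    vanishes {κ} κ⋖μ same = off-φ (IH-pred κ⋖μ) λ L′ e′ → p≢p-1 p (begin
      p          ≡⟨ sym e′ ⟩
      φ κ L′     ≡⟨ cong (φ κ) (φ-injective P (trans (p∉φ-pred nf κ⋖μ L′ e′) (sym eL))) ⟩
      φ κ L      ≡⟨ φ-equal-row μ κ L same ⟩
      φ μ L      ≡⟨ eL ⟩
      p - + 1 ∎)

  -- The predecessor of μ shortening row L cancels the shifted sum.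
  rowFormula-step-off-shifted : (∀ L → φ μ L ≢ p) → ∀ L → φ μ L ≡ p - + 1 → RHS μ p ≡ + 0
  rowFormula-step-off-shifted nf L eL with predsAt-single L μ rows-differ
    where
    rows-differ : row (suc L) μ ℕ.< row L μ
    rows-differ = ℕₚ.≤∧≢⇒< (row-suc-≤ P L) λ same →
      nf (suc L) (trans (φ-suc μ L (sym same)) (≡-1⇒+1≡ eL))
  ... | κ₀ , at≡ = begin
    RHS μ p
      ≡⟨ RHS-pascal p m P e ⟩
    sumOver R (preds μ []) + RHS μ (p - + 1)
      ≡⟨ cong₂ _+_ (sumOver-preds-split R L μ) (at-φ IH-shift L eL) ⟩
    (sumOver R (predsOff L μ) + sumOver R (predsAt L μ)) + sgn (row L μ) * F
      ≡⟨ cong (_+ sgn (row L μ) * F) (cong₂ _+_ (predsOff-RHS≡0 nf L eL) (cong (sumOver R) at≡)) ⟩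
    (+ 0 + (R κ₀ + + 0)) + sgn (row L μ) * F
      ≡⟨ cong (_+ sgn (row L μ) * F) (trans (ℤₚ.+-identityˡ _) (ℤₚ.+-identityʳ (R κ₀))) ⟩
    R κ₀ + sgn (row L μ) * F
      ≡⟨ cong₂ (λ a r → a + sgn r * F) Rκ₀ (sym shorter) ⟩
    sgn (row L κ₀) * F + sgn (suc (row L κ₀)) * F
      ≡⟨ sgn-cancel (row L κ₀) F ⟩
    + 0 ∎
    where
    open ≡-Reasoning
    F = + fStraight (Ψ L μ)
    κ₀⋖μ : κ₀ ⋖ μ
    κ₀⋖μ = All.head (subst (All (_⋖ μ)) at≡ (proj₂ (All-preds-split L μ (preds-⋖ P))))
    open RemovedFromRow (All.head (subst (All (RemovedFromRow L μ)) at≡ (predsAt-removed L P)))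
    Rκ₀ : R κ₀ ≡ sgn (row L κ₀) * F
    Rκ₀ = trans (at-φ (IH-pred κ₀⋖μ) L (trans (φ-shorter-row μ κ₀ L shorter) (≡-1⇒+1≡ eL)))
                (cong (λ ν → sgn (row L κ₀) * + fStraight ν) same-Ψ)

rowFormula : ∀ m {μ} p → IsPartition μ → p + + size μ ≡ + m → RowFormula μ p
rowFormula zero p P e = rowFormula-base P e
rowFormula (suc m) {μ} p P e = record
  { at-φ = rowFormula-step-at P e IH-pred IH-shift
  ; off-φ = λ nf → case φ⁻¹? μ (p - + 1) of λ
      { (inj₁ (L , eL)) → rowFormula-step-off-shifted P e IH-pred IH-shift nf L eL
      ; (inj₂ nf′) → rowFormula-step-off-both P e IH-pred IH-shift nf nf′ } }
  where
  IH-pred : ∀ {κ} → κ ⋖ μ → RowFormula κ p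
  IH-pred κ⋖μ = rowFormula m p (_⋖_.isPartition κ⋖μ) (predecessor-size p κ⋖μ e)
  IH-shift : RowFormula μ (p - + 1)
  IH-shift = rowFormula m (p - + 1) P (shift-size p e)

φ<conj-diff : ∀ {μ} → IsPartition μ → ∀ L i → 1 ℕ.≤ i → i ℕ.≤ row L μ → φ μ L ℤ.< + conj μ i - + i
φ<conj-diff {μ} P L i 1≤i le = diff<diff L (row L μ) (conj μ i) i (ℕₚ.+-mono-<-≤ (≤row⇒<conj P L i 1≤i le) le)

conj-diff<φ : ∀ {μ} → IsPartition μ → ∀ L i → row L μ ℕ.< i → + conj μ i - + i ℤ.< φ μ L
conj-diff<φ {μ} P L i lt = diff<diff (conj μ i) i L (row L μ) (ℕₚ.+-mono-≤-< conj≤L lt)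
  where
  conj≤L : conj μ i ℕ.≤ L
  conj≤L = ℕₚ.≮⇒≥ λ L<conj → ℕₚ.<⇒≱ lt (<conj⇒≤row P L i (ℕₚ.≤-trans (s≤s z≤n) lt) L<conj)

IsMinA⇒a≡ : ∀ {μ p a} → IsPartition μ → IsMinA μ p a → ∀ L → φ μ L ≡ p → a ≡ suc (row L μ)
IsMinA⇒a≡ {μ} {a = a} P (1≤a , reached , minimal) L refl with ℕₚ.<-cmp a (suc (row L μ))
... | tri< a≤n _ _ = ⊥-elim (ℤₚ.<-irrefl refl (ℤₚ.<-≤-trans (φ<conj-diff P L a 1≤a (ℕₚ.≤-pred a≤n)) reached))
... | tri≈ _ a≡ _ = a≡
... | tri> _ _ n<a = ⊥-elim (ℤₚ.<-irrefl refl
        (ℤₚ.<-trans (minimal (suc (row L μ)) (s≤s z≤n) n<a) (conj-diff<φ P L (suc (row L μ)) ℕₚ.≤-refl)))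

-- The witness is L = λ′'_a.
hasColumns⇒φ : ∀ {μ p a λ′} → IsPartition μ → IsMinA μ p a → HasColumns λ′ (colP μ p a) →
               Σ ℕ λ L → φ μ L ≡ p
hasColumns⇒φ {μ} {p} {suc a₀} {λ′} P (_ , _ , minimal) (_ , cols) = L , trans (cong (λ r → + L - + r) row≡a₀) L-a₀≡p
  where
  L = conj λ′ (suc a₀)
  L-a₀≡p : + L - + a₀ ≡ p
  L-a₀≡p = trans (cong (_- + a₀) (trans (cols (suc a₀) (s≤s z≤n)) (colP-≡ μ p (suc a₀)))) (cancel p (+ a₀))
    where
    cancel : ∀ p a → p + (+ 1 + a) - + 1 - a ≡ p
    cancel = solve-∀
  conjμ≤L : conj μ (suc a₀) ℕ.≤ L
  conjμ≤L = subst (ℕ._≤ L) (ℤₚ.+-injective (trans (cols (suc (suc a₀)) (s≤s z≤n)) (colP-> μ p (ℕₚ.n<1+n (suc a₀)))))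
                  (conj-suc-≤ λ′ (suc a₀))
  row<a : row L μ ℕ.< suc a₀
  row<a = ℕₚ.≰⇒> λ a≤row → ℕₚ.<⇒≱ (≤row⇒<conj P L (suc a₀) (s≤s z≤n) a≤row) conjμ≤L
  a₀≤row : ∀ a₀ → (∀ i → 1 ℕ.≤ i → i ℕ.< suc a₀ → p ℤ.< + conj μ i - + i) → + L - + a₀ ≡ p → a₀ ℕ.≤ row L μ
  a₀≤row zero _ _ = z≤n
  a₀≤row (suc b) minimal e = <conj⇒≤row P L (suc b) (s≤s z≤n)
    (ℕₚ.+-cancelʳ-< (suc b) L (conj μ (suc b))
      (diff<diff⁻¹ L (suc b) (conj μ (suc b)) (suc b) (subst (ℤ._< + conj μ (suc b) - + suc b) (sym e)
        (minimal (suc b) (s≤s z≤n) (ℕₚ.n<1+n (suc b))))))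
  row≡a₀ : row L μ ≡ a₀
  row≡a₀ = ℕₚ.≤-antisym (ℕₚ.≤-pred row<a) (a₀≤row a₀ minimal L-a₀≡p)

hasColumns-unique : ∀ {λ₁ λ₂ c} → HasColumns λ₁ c → HasColumns λ₂ c → λ₁ ≡ λ₂
hasColumns-unique (P₁ , c₁) (P₂ , c₂) =
  conj-injective P₁ P₂ λ i 1≤i → ℤₚ.+-injective (trans (c₁ i 1≤i) (sym (c₂ i 1≤i)))

-- At p = μ'_a − a, column a of μ^{(p)} would be shorter than column a + 1.
boundary-noColumns : ∀ {μ p a λ′} → 1 ℕ.≤ a → p ≡ + conj μ a - + a → ¬ HasColumns λ′ (colP μ p a)
boundary-noColumns {μ} {p} {a} {λ′} 1≤a refl (_ , cols) = ℕₚ.<⇒≱ grows (conj-suc-≤ λ′ a)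
  where
  grows : conj λ′ a ℕ.< conj λ′ (suc a)
  grows = ℕₚ.≤-reflexive (ℤₚ.+-injective (begin
    + 1 + + conj λ′ a                              ≡⟨ cong (_+_ (+ 1)) (trans (cols a 1≤a) (colP-≡ μ p a)) ⟩
    + 1 + (+ conj μ a - + a + + a - + 1)            ≡⟨ cancel (+ conj μ a) (+ a) ⟩
    + conj μ a                                     ≡⟨ sym (trans (cols (suc a) (s≤s z≤n)) (colP-> μ p (ℕₚ.n<1+n a))) ⟩
    + conj λ′ (suc a) ∎))
    where
    open ≡-Reasoning
    cancel : ∀ c a → + 1 + (c - a + a - + 1) ≡ c
    cancel = solve-∀

lemma3p4 : (μ : List ℕ) → IsPartition μ → (p : ℤ) → + 0 ≤ p + + size μ →
    (a : ℕ) → IsMinA μ p a →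
    ((λ′ : List ℕ) → HasColumns λ′ (colP μ p a) →
        sgn (Data.Nat._+_ a 1) * + fStraight λ′ ≡ RHS μ p)
    × (((λ′ : List ℕ) → ¬ HasColumns λ′ (colP μ p a)) → RHS μ p ≡ + 0)
    × (p ≡ + conj μ a - + a → RHS μ p ≡ + 0)
lemma3p4 μ P p 0≤p+|μ| a minA = at-μ⁽ᵖ⁾ , no-μ⁽ᵖ⁾ , λ p≡ → no-μ⁽ᵖ⁾ λ λ′ → boundary-noColumns {μ} (proj₁ minA) p≡
  where
  open RowFormula (rowFormula ℤ.∣ p + + size μ ∣ p P (sym (ℤₚ.0≤i⇒+∣i∣≡i 0≤p+|μ|)))
  Ψ-columns : ∀ L → φ μ L ≡ p → HasColumns (Ψ L μ) (colP μ p a)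
  Ψ-columns L eL = subst (λ a → HasColumns (Ψ L μ) (colP μ p a)) (sym (IsMinA⇒a≡ P minA L eL)) (Ψ-hasColumns L P eL)
  at-μ⁽ᵖ⁾ : ∀ λ′ → HasColumns λ′ (colP μ p a) → sgn (a ℕ.+ 1) * + fStraight λ′ ≡ RHS μ p
  at-μ⁽ᵖ⁾ λ′ cols with hasColumns⇒φ P minA cols
  ... | L , eL = begin
    sgn (a ℕ.+ 1) * + fStraight λ′
      ≡⟨ cong₂ (λ k ν → sgn (k ℕ.+ 1) * + fStraight ν) (IsMinA⇒a≡ P minA L eL) (hasColumns-unique cols (Ψ-columns L eL)) ⟩
    sgn (suc (row L μ) ℕ.+ 1) * F
      ≡⟨ cong (λ k → sgn k * F) (ℕₚ.+-comm (suc (row L μ)) 1) ⟩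
    sgn (suc (suc (row L μ))) * F
      ≡⟨ cong (_* F) (sgn-suc-suc (row L μ)) ⟩
    sgn (row L μ) * F
      ≡⟨ sym (at-φ L eL) ⟩
    RHS μ p ∎
    where
    open ≡-Reasoning
    F = + fStraight (Ψ L μ)
  no-μ⁽ᵖ⁾ : (∀ λ′ → ¬ HasColumns λ′ (colP μ p a)) → RHS μ p ≡ + 0
  no-μ⁽ᵖ⁾ none = off-φ λ L eL → none (Ψ L μ) (Ψ-columns L eL)
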